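{- Let $r>t\ge 2$. If $F_<$ is an ordered Steiner $(r,t)$-system that is not complete, then $\mathscr{S}_<(r,t)$ does not have the $F_<$-Ramsey property.
   Context: An $r$-graph is a pair $(V,E)$ with $E\subseteq\binom{V}{r}$; a Steiner $(r,t)$-system is an $r$-graph in which every $t$-subset of vertices lies in at most one edge; it is complete if every $t$-subset of its vertices lies in some edge. An ordered Steiner system carries a fixed linear order on its vertices; subsystems inherit the order and isomorphisms must be order-preserving. $\mathscr{S}_<(r,t)$ is the class of ordered Steiner $(r,t)$-systems with induced subsystems as subobjects ($G\le H$ iff $V(G)\subseteq V(H)$ and $E(G)=E(H)\cap\binom{V(G)}{r}$). $\binom{G_<}{F_<}$ is the set of induced subsystems of $G_<$ order-isomorphic to $F_<$; $H_<\to(G_<)^{F_<}_c$ means every $c$-colouring of $\binom{H_<}{F_<}$ admits $\widetilde G_<\in\binom{H_<}{G_<}$ with $\binom{\widetilde G_<}{F_<}$ monochromatic; the class has the $F_<$-Ramsey property if for every $G_<$ in the class and every positive integer $c$ there is $H_<$ in the class with $H_<\to(G_<)^{F_<}_c$. -}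

module Defs where

open import Data.Nat using (ℕ; _<_)
open import Data.Bool using (Bool; true; false)
open import Data.Fin using (Fin; _≟_) renaming (_<_ to _<ᶠ_)
open import Data.Fin.Subset using (Subset; _∈_; _⊆_; ∣_∣)
open import Data.Fin.Subset.Properties using (_∈?_)
open import Data.Fin.Properties using (any?)
open import Data.Vec using (tabulate)
open import Data.Product using (Σ; ∃; _×_; _,_)
open import Relation.Nullary using (¬_; does)
open import Relation.Nullary.Decidable using (_×-dec_)
open import Relation.Binary.PropositionalEquality using (_≡_)

-- An ordered Steiner (r,t)-system: vertex set Fin n with its natural linear
-- order, edges given by a Boolean predicate on subsets of the vertex set.
record OSteiner (r t : ℕ) : Set where
  field
    n       : ℕ
    Edge    : Subset n → Bool
    edge-r  : ∀ e → Edge e ≡ true → ∣ e ∣ ≡ r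
    steiner : ∀ (T e f : Subset n) → ∣ T ∣ ≡ t → T ⊆ e → T ⊆ f →
              Edge e ≡ true → Edge f ≡ true → e ≡ f
open OSteiner public

Complete : ∀ {r t} → OSteiner r t → Set
Complete {r} {t} F = ∀ (T : Subset (n F)) → ∣ T ∣ ≡ t →
  ∃ λ (e : Subset (n F)) → Edge F e ≡ true × T ⊆ e

image : ∀ {m k} → (Fin m → Fin k) → Subset m → Subset k
image φ S = tabulate (λ y → does (any? (λ x → (x ∈? S) ×-dec (φ x ≟ y))))

-- an order-preserving embedding of G onto an induced subsystem of H
-- (i.e. an element of binom(H, G), represented by the unique increasing
-- isomorphism onto it)
record Embedding {r t : ℕ} (G H : OSteiner r t) : Set where
  field
    map      : Fin (n G) → Fin (n H)
    monotone : ∀ i j → i <ᶠ j → map i <ᶠ map j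
    induced  : ∀ (S : Subset (n G)) → Edge G S ≡ Edge H (image map S)
open Embedding public

compose : ∀ {r t} {F G H : OSteiner r t} → Embedding G H → Embedding F G →
          (Fin (n F) → Fin (n H))
compose ψ φ x = map ψ (map φ x)

-- H → (G)^F_c : every c-colouring of the copies of F in H (copies identified
-- with their vertex sets) has a copy of G all of whose F-copies get one colour
Arrows : ∀ {r t} → (H G F : OSteiner r t) → ℕ → Set
Arrows H G F c = ∀ (χ : Subset (n H) → Fin c) →
  ∃ λ (ψ : Embedding G H) → ∃ λ (k : Fin c) →
    ∀ (φ : Embedding F G) → χ (image (compose {F = F} ψ φ) (tabulate (λ _ → true))) ≡ k

RamseyProperty : (r t : ℕ) → OSteiner r t → Set
RamseyProperty r t F = ∀ (G : OSteiner r t) (c : ℕ) → 0 < c →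
  ∃ λ (H : OSteiner r t) → Arrows H G F c

-- Let T be a t-set of F lying in no edge, and a = r − t ≥ 1. The witness G is two copies of F side
-- by side plus two extra edges: T in the lower copy together with a new vertices placed below
-- everything, and T in the upper copy together with a new vertices placed above everything. G is
-- again a Steiner system because T lies in no edge of F. Colour a copy of F in a host H by whether
-- the copy of T inside it lies in an edge of H having a vertex below the whole copy. In any copy of
-- G in H the lower copy of F gets colour 1, while the only edge through T in the upper copy is the
-- image of the upper extra edge, which has no vertex below that copy; so no H arrows G with two
-- colours. As covering is decidable, the Ramsey property therefore forces F to be complete.
module Submission where

open import Defs
open import Data.Nat using (ℕ; zero; suc; _+_; _<_; _≤_; z≤n; s≤s)
import Data.Nat.Properties as ℕ
open import Data.Bool using (Bool; true; false; if_then_else_)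
import Data.Bool.Properties as Bool
open import Data.Fin as Fin using (Fin; zero; suc; toℕ; punchOut; _↑ˡ_; _↑ʳ_)
  renaming (_<_ to _<ᶠ_)
import Data.Fin.Properties as Fin
open import Data.Fin.Subset using (Subset; _∈_; _⊆_; ∣_∣; ⊤; Nonempty)
open import Data.Fin.Subset.Properties
  using ( _∈?_; _⊆?_; nonempty?; anySubset?; ∈⊤; ∣⊤∣≡n; ∣⊥∣≡0; Empty-unique
        ; ⊆-reflexive; ⊆-antisym; p⊂q⇒∣p∣<∣q∣)
open import Data.Vec using ([]; _∷_; here; there; lookup; tabulate; _++_; toList)
import Data.Vec.Properties as Vec
open import Data.List using (List)
import Data.List as List
open import Data.Product using (∃; _×_; _,_; proj₁; proj₂)
open import Data.Sum using (_⊎_; inj₁; inj₂)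
open import Data.Empty using (⊥-elim)
open import Function using (_∘_; _⇔_; mk⇔; Equivalence; Injective)
open import Relation.Nullary using (¬_; Dec; yes; no; does; contradiction; map′)
open import Relation.Nullary.Decidable
  using (_×-dec_; _⊎-dec_; _→-dec_; dec-true; dec-false; does-⇔)
open import Relation.Binary.Definitions using (tri<; tri≈; tri>)
open import Relation.Binary.PropositionalEquality
  using (_≡_; _≢_; refl; sym; trans; cong; cong₂; subst; subst₂; module ≡-Reasoning)

private variable
  b c d l : ℕ

does≡true⇒ : ∀ {A : Set} (a? : Dec A) → does a? ≡ true → A
does≡true⇒ (yes a) _ = a

does≡⇔ : ∀ {A : Set} (a? : Dec A) {b : Bool} → A ⇔ (b ≡ true) → does a? ≡ b
does≡⇔ a? {true}  A⇔b = dec-true a? (Equivalence.from A⇔b refl)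
does≡⇔ a? {false} A⇔b = dec-false a? (λ a → contradiction (Equivalence.to A⇔b a) λ ())

tabulate-true≡⊤ : ∀ d → tabulate {n = d} (λ _ → true) ≡ ⊤
tabulate-true≡⊤ zero    = refl
tabulate-true≡⊤ (suc d) = cong (true ∷_) (tabulate-true≡⊤ d)

∣p++q∣≡∣p∣+∣q∣ : (p : Subset d) (q : Subset l) → ∣ p ++ q ∣ ≡ ∣ p ∣ + ∣ q ∣
∣p++q∣≡∣p∣+∣q∣ []          q = refl
∣p++q∣≡∣p∣+∣q∣ (true ∷ p)  q = cong suc (∣p++q∣≡∣p∣+∣q∣ p q)
∣p++q∣≡∣p∣+∣q∣ (false ∷ p) q = ∣p++q∣≡∣p∣+∣q∣ p q

∣x∷p∣≡∣x∷q∣ : ∀ x {p : Subset d} {q : Subset l} → ∣ p ∣ ≡ ∣ q ∣ → ∣ x ∷ p ∣ ≡ ∣ x ∷ q ∣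
∣x∷p∣≡∣x∷q∣ true  = cong suc
∣x∷p∣≡∣x∷q∣ false = λ ∣p∣≡∣q∣ → ∣p∣≡∣q∣

0<∣p∣⇒Nonempty : {p : Subset d} → 0 < ∣ p ∣ → Nonempty p
0<∣p∣⇒Nonempty {d} {p} 0<∣p∣ with nonempty? p
... | yes ne    = ne
... | no  empty = contradiction (trans (cong ∣_∣ (Empty-unique empty)) (∣⊥∣≡0 d)) (ℕ.>⇒≢ 0<∣p∣)

p⊆q∧∣p∣≡∣q∣⇒p≡q : {p q : Subset d} → p ⊆ q → ∣ p ∣ ≡ ∣ q ∣ → p ≡ q
p⊆q∧∣p∣≡∣q∣⇒p≡q {p = p} {q} p⊆q ∣p∣≡∣q∣ = ⊆-antisym p⊆q q⊆p
  where
  q⊆p : q ⊆ p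
  q⊆p {x} x∈q with x ∈? p
  ... | yes x∈p = x∈p
  ... | no  x∉p = contradiction ∣p∣≡∣q∣ (ℕ.<⇒≢ (p⊂q⇒∣p∣<∣q∣ (p⊆q , x , x∈q , x∉p)))

module _ (p : Subset d) (q : Subset l) where

  ∈-++⁺ˡ : ∀ {x} → x ∈ p → x ↑ˡ l ∈ p ++ q
  ∈-++⁺ˡ {x} x∈p = Vec.lookup⇒[]= _ _ (trans (Vec.lookup-++ˡ p q x) (Vec.[]=⇒lookup x∈p))

  ∈-++⁻ˡ : ∀ {x} → x ↑ˡ l ∈ p ++ q → x ∈ p
  ∈-++⁻ˡ {x} x∈ = Vec.lookup⇒[]= _ _ (trans (sym (Vec.lookup-++ˡ p q x)) (Vec.[]=⇒lookup x∈))

  ∈-++⁺ʳ : ∀ {y} → y ∈ q → d ↑ʳ y ∈ p ++ q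
  ∈-++⁺ʳ {y} y∈q = Vec.lookup⇒[]= _ _ (trans (Vec.lookup-++ʳ p q y) (Vec.[]=⇒lookup y∈q))

  ∈-++⁻ʳ : ∀ {y} → d ↑ʳ y ∈ p ++ q → y ∈ q
  ∈-++⁻ʳ {y} y∈ = Vec.lookup⇒[]= _ _ (trans (sym (Vec.lookup-++ʳ p q y)) (Vec.[]=⇒lookup y∈))

StrictlyIncreasing : (Fin c → Fin b) → Set
StrictlyIncreasing g = ∀ i j → i <ᶠ j → g i <ᶠ g j

module _ {g : Fin c → Fin b} (g↑ : StrictlyIncreasing g) where

  strictlyIncreasing⇒injective : Injective _≡_ _≡_ g
  strictlyIncreasing⇒injective {i} {j} gi≡gj with Fin.<-cmp i j
  ... | tri< i<j _ _ = contradiction (cong toℕ gi≡gj) (ℕ.<⇒≢ (g↑ i j i<j))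
  ... | tri≈ _ i≡j _ = i≡j
  ... | tri> _ _ j<i = contradiction (cong toℕ gi≡gj) (ℕ.>⇒≢ (g↑ j i j<i))

  ∘-strictlyIncreasing : {f : Fin b → Fin d} → StrictlyIncreasing f → StrictlyIncreasing (λ x → f (g x))
  ∘-strictlyIncreasing f↑ i j i<j = f↑ (g i) (g j) (g↑ i j i<j)

shift-strictlyIncreasing : {g : Fin c → Fin b} (o : ℕ) → (∀ x → toℕ (g x) ≡ o + toℕ x) →
                           StrictlyIncreasing g
shift-strictlyIncreasing o toℕ-g i j i<j =
  subst₂ _<_ (sym (toℕ-g i)) (sym (toℕ-g j)) (ℕ.+-monoʳ-< o i<j)

image? : (g : Fin c → Fin b) (X : Subset c) (y : Fin b) → Dec (∃ λ x → x ∈ X × g x ≡ y)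
image? g X y = Fin.any? (λ x → (x ∈? X) ×-dec (g x Fin.≟ y))

module _ (g : Fin c → Fin b) where

  lookup-image : ∀ X y → lookup (image g X) y ≡ does (image? g X y)
  lookup-image X y = Vec.lookup∘tabulate _ y

  ∈-image⁺ : ∀ {X x} → x ∈ X → g x ∈ image g X
  ∈-image⁺ {X} {x} x∈X = Vec.lookup⇒[]= _ _
    (trans (lookup-image X (g x)) (dec-true (image? g X (g x)) (x , x∈X , refl)))

  ∈-image⁻ : ∀ {X y} → y ∈ image g X → ∃ λ x → x ∈ X × g x ≡ y
  ∈-image⁻ {X} {y} y∈ = does≡true⇒ (image? g X y) (trans (sym (lookup-image X y)) (Vec.[]=⇒lookup y∈))

  preimage : Subset b → Subset c
  preimage U = tabulate (λ x → lookup U (g x))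

  ∈-preimage⁺ : ∀ {U x} → g x ∈ U → x ∈ preimage U
  ∈-preimage⁺ {U} {x} gx∈U = Vec.lookup⇒[]= _ _
    (trans (Vec.lookup∘tabulate _ x) (Vec.[]=⇒lookup gx∈U))

  ∈-preimage⁻ : ∀ {U x} → x ∈ preimage U → g x ∈ U
  ∈-preimage⁻ {U} {x} x∈ = Vec.lookup⇒[]= _ _
    (trans (sym (Vec.lookup∘tabulate _ x)) (Vec.[]=⇒lookup x∈))

  image-preimage : ∀ {U X} → U ⊆ image g X → image g (preimage U) ≡ U
  image-preimage {U} U⊆ = ⊆-antisym image⊆U U⊆image
    where
    image⊆U : image g (preimage U) ⊆ U
    image⊆U v∈ with ∈-image⁻ v∈
    ... | x , x∈ , refl = ∈-preimage⁻ x∈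
    U⊆image : U ⊆ image g (preimage U)
    U⊆image v∈U with ∈-image⁻ (U⊆ v∈U)
    ... | x , _ , refl = ∈-image⁺ (∈-preimage⁺ v∈U)

  module _ (g-inj : Injective _≡_ _≡_ g) where

    ∈-image-injective : ∀ {X x} → g x ∈ image g X → x ∈ X
    ∈-image-injective gx∈ with ∈-image⁻ gx∈
    ... | x , x∈X , gx≡ = subst (_∈ _) (g-inj gx≡) x∈X

    image-⊆⇒⊆ : ∀ {X Y} → image g X ⊆ image g Y → X ⊆ Y
    image-⊆⇒⊆ gX⊆gY x∈X = ∈-image-injective (gX⊆gY (∈-image⁺ x∈X))

    image-injective : Injective _≡_ _≡_ (image g)
    image-injective gX≡gY =
      ⊆-antisym (image-⊆⇒⊆ (⊆-reflexive gX≡gY)) (image-⊆⇒⊆ (⊆-reflexive (sym gX≡gY)))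

dropZero : (g : Fin c → Fin (suc b)) → (∀ x → zero ≢ g x) → Fin c → Fin b
dropZero g 0∉g x = punchOut (0∉g x)

module _ (g : Fin c → Fin (suc b)) (0∉g : ∀ x → zero ≢ g x) where

  suc∘dropZero : ∀ x → suc (dropZero g 0∉g x) ≡ g x
  suc∘dropZero x = Fin.punchIn-punchOut (0∉g x)

  dropZero-strictlyIncreasing : StrictlyIncreasing g → StrictlyIncreasing (dropZero g 0∉g)
  dropZero-strictlyIncreasing g↑ i j i<j = ℕ.≤-pred
    (subst₂ _<ᶠ_ (sym (suc∘dropZero i)) (sym (suc∘dropZero j)) (g↑ i j i<j))

  ∃-image-suc⇔ : ∀ X y → (∃ λ x → x ∈ X × g x ≡ suc y) ⇔ (∃ λ x → x ∈ X × dropZero g 0∉g x ≡ y)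
  ∃-image-suc⇔ X y = mk⇔
    (λ (x , x∈X , gx≡) → x , x∈X , Fin.suc-injective (trans (suc∘dropZero x) gx≡))
    (λ { (x , x∈X , refl) → x , x∈X , sym (suc∘dropZero x) })

  image-avoiding-zero : ∀ X → image g X ≡ false ∷ image (dropZero g 0∉g) X
  image-avoiding-zero X = cong₂ _∷_
    (dec-false (image? g X zero) (λ (x , _ , gx≡0) → 0∉g x (sym gx≡0)))
    (Vec.tabulate-cong λ y →
      does-⇔ (∃-image-suc⇔ X y) (image? g X (suc y)) (image? (dropZero g 0∉g) X y))

zero∉g∘suc : {g : Fin (suc c) → Fin (suc b)} → StrictlyIncreasing g → ∀ x → zero ≢ g (suc x)
zero∉g∘suc {g = g} g↑ x 0≡g[1+x] =
  ℕ.n≮0 (subst (λ v → toℕ (g zero) < toℕ v) (sym 0≡g[1+x]) (g↑ zero (suc x) (s≤s z≤n)))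

zero∉g : {g : Fin (suc c) → Fin (suc b)} → StrictlyIncreasing g → g zero ≢ zero → ∀ x → zero ≢ g x
zero∉g g↑ g0≢0 zero    0≡g0 = g0≢0 (sym 0≡g0)
zero∉g g↑ g0≢0 (suc x) = zero∉g∘suc g↑ x

module _ {g : Fin (suc c) → Fin (suc b)} (g↑ : StrictlyIncreasing g) where

  dropZero∘suc : Fin c → Fin b
  dropZero∘suc = dropZero (λ x → g (suc x)) (zero∉g∘suc g↑)

  suc∘dropZero∘suc : ∀ z → suc (dropZero∘suc z) ≡ g (suc z)
  suc∘dropZero∘suc = suc∘dropZero (λ x → g (suc x)) (zero∉g∘suc g↑)

  dropZero∘suc-strictlyIncreasing : StrictlyIncreasing dropZero∘suc
  dropZero∘suc-strictlyIncreasing = dropZero-strictlyIncreasing _ (zero∉g∘suc g↑)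
    (λ i j i<j → g↑ (suc i) (suc j) (s≤s i<j))

  image-from-zero : g zero ≡ zero → ∀ x X → image g (x ∷ X) ≡ x ∷ image dropZero∘suc X
  image-from-zero g0≡0 x X = cong₂ _∷_ (does≡⇔ (image? g (x ∷ X) zero) (head⇔ x))
    (Vec.tabulate-cong (λ y → does-⇔ (tail⇔ y) (image? g (x ∷ X) (suc y)) (image? dropZero∘suc X y)))
    where
    head⇔ : ∀ x → (∃ λ z → z ∈ x ∷ X × g z ≡ zero) ⇔ (x ≡ true)
    head⇔ x = mk⇔
      (λ { (zero , here , _) → refl
         ; (suc z , _ , g[1+z]≡0) → contradiction (sym g[1+z]≡0) (zero∉g∘suc g↑ z) })
      (λ { refl → zero , here , g0≡0 })
    tail⇔ : ∀ y → (∃ λ z → z ∈ x ∷ X × g z ≡ suc y) ⇔ (∃ λ z → z ∈ X × dropZero∘suc z ≡ y)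
    tail⇔ y = mk⇔
      (λ { (zero , _ , g0≡1+y) → contradiction (trans (sym g0≡0) g0≡1+y) Fin.0≢1+n
         ; (suc z , there z∈X , g[1+z]≡1+y) →
             z , z∈X , Fin.suc-injective (trans (suc∘dropZero∘suc z) g[1+z]≡1+y) })
      (λ { (z , z∈X , refl) → suc z , there z∈X , sym (suc∘dropZero∘suc z) })

-- select S bs keeps the i-th element of S (in increasing order) iff the i-th entry of bs is true.
select : Subset d → List Bool → Subset d
select []          _             = []
select (false ∷ S) bs            = false ∷ select S bs
select (true ∷ S)  List.[]       = false ∷ select S List.[]
select (true ∷ S)  (b List.∷ bs) = b ∷ select S bs

mutual
  select-image : ∀ b {c} (g : Fin c → Fin b) → StrictlyIncreasing g →
                 ∀ X → select (image g ⊤) (toList X) ≡ image g X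
  select-image zero    {zero}  g g↑ [] = refl
  select-image zero    {suc c} g g↑ X  with () ← g zero
  select-image (suc b) {zero}  g g↑ [] = select-image-avoiding-zero b g (λ ()) g↑ []
  select-image (suc b) {suc c} g g↑ (x ∷ X) = by-cases (g zero Fin.≟ zero)
    where
    open ≡-Reasoning
    by-cases : Dec (g zero ≡ zero) → select (image g ⊤) (toList (x ∷ X)) ≡ image g (x ∷ X)
    by-cases (no g0≢0) = select-image-avoiding-zero b g (zero∉g g↑ g0≢0) g↑ (x ∷ X)
    by-cases (yes g0≡0) = begin
      select (image g ⊤) (toList (x ∷ X))
        ≡⟨ cong (λ V → select V (toList (x ∷ X))) (image-from-zero g↑ g0≡0 true ⊤) ⟩
      x ∷ select (image (dropZero∘suc g↑) ⊤) (toList X)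
        ≡⟨ cong (x ∷_) (select-image b _ (dropZero∘suc-strictlyIncreasing g↑) X) ⟩
      x ∷ image (dropZero∘suc g↑) X
        ≡⟨ sym (image-from-zero g↑ g0≡0 x X) ⟩
      image g (x ∷ X)
        ∎

  select-image-avoiding-zero : ∀ b {c} (g : Fin c → Fin (suc b)) (0∉g : ∀ x → zero ≢ g x) →
                               StrictlyIncreasing g → ∀ X → select (image g ⊤) (toList X) ≡ image g X
  select-image-avoiding-zero b g 0∉g g↑ X = begin
    select (image g ⊤) (toList X)
      ≡⟨ cong (λ V → select V (toList X)) (image-avoiding-zero g 0∉g ⊤) ⟩
    false ∷ select (image (dropZero g 0∉g) ⊤) (toList X)
      ≡⟨ cong (false ∷_) (select-image b _ (dropZero-strictlyIncreasing g 0∉g g↑) X) ⟩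
    false ∷ image (dropZero g 0∉g) X
      ≡⟨ sym (image-avoiding-zero g 0∉g X) ⟩
    image g X
      ∎
    where open ≡-Reasoning

mutual
  ∣image∣≡∣X∣ : ∀ b {c} (g : Fin c → Fin b) → StrictlyIncreasing g → ∀ X → ∣ image g X ∣ ≡ ∣ X ∣
  ∣image∣≡∣X∣ zero    {zero}  g g↑ [] = refl
  ∣image∣≡∣X∣ zero    {suc c} g g↑ X  with () ← g zero
  ∣image∣≡∣X∣ (suc b) {zero}  g g↑ [] = ∣image∣≡∣X∣-avoiding-zero b g (λ ()) g↑ []
  ∣image∣≡∣X∣ (suc b) {suc c} g g↑ (x ∷ X) = by-cases (g zero Fin.≟ zero)
    where
    by-cases : Dec (g zero ≡ zero) → ∣ image g (x ∷ X) ∣ ≡ ∣ x ∷ X ∣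
    by-cases (no g0≢0) = ∣image∣≡∣X∣-avoiding-zero b g (zero∉g g↑ g0≢0) g↑ (x ∷ X)
    by-cases (yes g0≡0) = trans (cong ∣_∣ (image-from-zero g↑ g0≡0 x X))
      (∣x∷p∣≡∣x∷q∣ x {image (dropZero∘suc g↑) X} {X}
        (∣image∣≡∣X∣ b _ (dropZero∘suc-strictlyIncreasing g↑) X))

  ∣image∣≡∣X∣-avoiding-zero : ∀ b {c} (g : Fin c → Fin (suc b)) (0∉g : ∀ x → zero ≢ g x) →
                              StrictlyIncreasing g → ∀ X → ∣ image g X ∣ ≡ ∣ X ∣
  ∣image∣≡∣X∣-avoiding-zero b g 0∉g g↑ X = trans (cong ∣_∣ (image-avoiding-zero g 0∉g X))
    (∣image∣≡∣X∣ b _ (dropZero-strictlyIncreasing g 0∉g g↑) X)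

-- A copy of F in H is given by its vertex set S, and select S (toList T) is then its copy of T.
ExtendsBelow : ∀ {r t} (H : OSteiner r t) → List Bool → Subset (n H) → Set
ExtendsBelow H bs S =
  ∃ λ e → Edge H e ≡ true × select S bs ⊆ e × ∃ λ y → y ∈ e × (∀ x → x ∈ S → y <ᶠ x)

extendsBelow? : ∀ {r t} (H : OSteiner r t) bs S → Dec (ExtendsBelow H bs S)
extendsBelow? H bs S = anySubset? λ e →
  (Edge H e Bool.≟ true) ×-dec (select S bs ⊆? e) ×-dec
  Fin.any? (λ y → (y ∈? e) ×-dec Fin.all? (λ x → (x ∈? S) →-dec (y Fin.<? x)))

colouring : ∀ {r t} (H : OSteiner r t) → List Bool → Subset (n H) → Fin 2
colouring H bs S = if does (extendsBelow? H bs S) then suc zero else zero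

module Gadget {r t : ℕ} (F : OSteiner r t) (k : ℕ) (1+k+t≡r : suc k + t ≡ r) (0<t : 0 < t)
              (T : Subset (n F)) (∣T∣≡t : ∣ T ∣ ≡ t) (T-uncovered : ∀ e → Edge F e ≡ true → ¬ T ⊆ e) where

  -- Vertices of G, in order: a new vertices, the lower copy of F, the upper copy, a new vertices.
  m a N : ℕ
  m = n F
  a = suc k
  N = (a + m) + (m + a)

  inˡ : Fin (a + m) → Fin N
  inˡ w = w ↑ˡ (m + a)

  inʳ : Fin (m + a) → Fin N
  inʳ w = (a + m) ↑ʳ w

  data Half : Set where
    lower upper : Half

  copy : Half → Fin m → Fin N
  copy lower x = inˡ (a ↑ʳ x)
  copy upper x = inʳ (x ↑ˡ a)

  cap : Half → Subset N
  cap lower = image inˡ (⊤ ++ T)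
  cap upper = image inʳ (T ++ ⊤)

  corner : Half → Fin N
  corner lower = inˡ (zero ↑ˡ m)
  corner upper = inʳ (m ↑ʳ zero)

  _liesIn_ : Fin N → Half → Set
  v liesIn lower = toℕ v < a + m
  v liesIn upper = a + m ≤ toℕ v

  offset : Half → ℕ
  offset lower = a
  offset upper = a + m

  toℕ-inʳ : ∀ w → toℕ (inʳ w) ≡ a + m + toℕ w
  toℕ-inʳ = Fin.toℕ-↑ʳ (a + m)

  toℕ-copy : ∀ h x → toℕ (copy h x) ≡ offset h + toℕ x
  toℕ-copy lower x = trans (Fin.toℕ-↑ˡ (a ↑ʳ x) (m + a)) (Fin.toℕ-↑ʳ a x)
  toℕ-copy upper x = trans (toℕ-inʳ (x ↑ˡ a)) (cong (a + m +_) (Fin.toℕ-↑ˡ x a))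

  inˡ-strictlyIncreasing : StrictlyIncreasing inˡ
  inˡ-strictlyIncreasing = shift-strictlyIncreasing 0 (λ w → Fin.toℕ-↑ˡ w (m + a))

  inʳ-strictlyIncreasing : StrictlyIncreasing inʳ
  inʳ-strictlyIncreasing = shift-strictlyIncreasing (a + m) toℕ-inʳ

  copy-strictlyIncreasing : ∀ h → StrictlyIncreasing (copy h)
  copy-strictlyIncreasing h = shift-strictlyIncreasing (offset h) (toℕ-copy h)

  copy-injective : ∀ h → Injective _≡_ _≡_ (copy h)
  copy-injective h = strictlyIncreasing⇒injective (copy-strictlyIncreasing h)

  corner<copy-lower : ∀ x → corner lower <ᶠ copy lower x
  corner<copy-lower x = subst (0 <_) (sym (toℕ-copy lower x)) (s≤s z≤n)

  copy-upper<beyond : ∀ x j → copy upper x <ᶠ inʳ (m ↑ʳ j)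
  copy-upper<beyond x j = subst₂ _<_ (sym (toℕ-copy upper x))
    (sym (trans (toℕ-inʳ (m ↑ʳ j)) (cong (a + m +_) (Fin.toℕ-↑ʳ m j))))
    (ℕ.+-monoʳ-< (a + m) (ℕ.<-≤-trans (Fin.toℕ<n x) (ℕ.m≤m+n m (toℕ j))))

  corner≢copy : ∀ h x → corner h ≢ copy h x
  corner≢copy lower x = ℕ.<⇒≢ (corner<copy-lower x) ∘ cong toℕ
  corner≢copy upper x = ℕ.>⇒≢ (copy-upper<beyond x zero) ∘ cong toℕ

  liesIn-unique : ∀ {v h h′} → v liesIn h → v liesIn h′ → h ≡ h′
  liesIn-unique {h = lower} {lower} _ _ = refl
  liesIn-unique {h = lower} {upper} v<  ≤v = contradiction v< (ℕ.≤⇒≯ ≤v)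
  liesIn-unique {h = upper} {lower} ≤v v<  = contradiction v< (ℕ.≤⇒≯ ≤v)
  liesIn-unique {h = upper} {upper} _ _ = refl

  inˡ-liesIn : ∀ w → inˡ w liesIn lower
  inˡ-liesIn w = subst (_< a + m) (sym (Fin.toℕ-↑ˡ w (m + a))) (Fin.toℕ<n w)

  inʳ-liesIn : ∀ w → inʳ w liesIn upper
  inʳ-liesIn w = subst (a + m ≤_) (sym (toℕ-inʳ w)) (ℕ.m≤m+n (a + m) (toℕ w))

  copy-liesIn : ∀ h x → copy h x liesIn h
  copy-liesIn lower x = inˡ-liesIn (a ↑ʳ x)
  copy-liesIn upper x = inʳ-liesIn (x ↑ˡ a)

  cap-liesIn : ∀ h {v} → v ∈ cap h → v liesIn h
  cap-liesIn lower v∈ with ∈-image⁻ inˡ {⊤ ++ T} v∈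
  ... | w , _ , refl = inˡ-liesIn w
  cap-liesIn upper v∈ with ∈-image⁻ inʳ {T ++ ⊤} v∈
  ... | w , _ , refl = inʳ-liesIn w

  copy∈cap : ∀ h {x} → x ∈ T → copy h x ∈ cap h
  copy∈cap lower x∈T = ∈-image⁺ inˡ (∈-++⁺ʳ ⊤ T x∈T)
  copy∈cap upper x∈T = ∈-image⁺ inʳ (∈-++⁺ˡ T ⊤ x∈T)

  copy∈cap⇒∈T : ∀ h {x} → copy h x ∈ cap h → x ∈ T
  copy∈cap⇒∈T lower x∈ =
    ∈-++⁻ʳ ⊤ T (∈-image-injective inˡ (strictlyIncreasing⇒injective inˡ-strictlyIncreasing) {⊤ ++ T} x∈)
  copy∈cap⇒∈T upper x∈ =
    ∈-++⁻ˡ T ⊤ (∈-image-injective inʳ (strictlyIncreasing⇒injective inʳ-strictlyIncreasing) {T ++ ⊤} x∈)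

  corner∈cap : ∀ h → corner h ∈ cap h
  corner∈cap lower = ∈-image⁺ inˡ (∈-++⁺ˡ ⊤ T ∈⊤)
  corner∈cap upper = ∈-image⁺ inʳ (∈-++⁺ʳ T ⊤ ∈⊤)

  cap-upper-inside-or-above : ∀ {v} → v ∈ cap upper →
    (∃ λ w → w ∈ T × copy upper w ≡ v) ⊎ (∀ x → copy upper x <ᶠ v)
  cap-upper-inside-or-above v∈ with ∈-image⁻ inʳ {T ++ ⊤} v∈
  ... | w , w∈ , refl with Fin.splitAt m w in eq
  ...   | inj₁ j with refl ← Fin.splitAt⁻¹-↑ˡ eq = inj₁ (j , ∈-++⁻ˡ T ⊤ w∈ , refl)
  ...   | inj₂ j with refl ← Fin.splitAt⁻¹-↑ʳ eq = inj₂ (λ x → copy-upper<beyond x j)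

  EdgeIn : Half → Subset N → Set
  EdgeIn h U = (∃ λ S → Edge F S ≡ true × U ≡ image (copy h) S) ⊎ U ≡ cap h

  IsEdge : Subset N → Set
  IsEdge U = ∃ λ h → EdgeIn h U

  isEdge? : ∀ U → Dec (IsEdge U)
  isEdge? U = map′ (λ { (inj₁ e) → lower , e ; (inj₂ e) → upper , e })
                   (λ { (lower , e) → inj₁ e ; (upper , e) → inj₂ e })
                   (edgeIn? lower ⊎-dec edgeIn? upper)
    where
    edgeIn? : ∀ h → Dec (EdgeIn h U)
    edgeIn? h = anySubset? (λ S → (Edge F S Bool.≟ true) ×-dec Vec.≡-dec Bool._≟_ U (image (copy h) S))
                ⊎-dec Vec.≡-dec Bool._≟_ U (cap h)

  edge-card : ∀ h {U} → EdgeIn h U → ∣ U ∣ ≡ r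
  edge-card h (inj₁ (S , S-edge , refl)) =
    trans (∣image∣≡∣X∣ N (copy h) (copy-strictlyIncreasing h) S) (edge-r F S S-edge)
  edge-card lower (inj₂ refl) = begin
    ∣ image inˡ (⊤ {a} ++ T) ∣ ≡⟨ ∣image∣≡∣X∣ N inˡ inˡ-strictlyIncreasing (⊤ {a} ++ T) ⟩
    ∣ ⊤ {a} ++ T ∣            ≡⟨ ∣p++q∣≡∣p∣+∣q∣ (⊤ {a}) T ⟩
    ∣ ⊤ {a} ∣ + ∣ T ∣         ≡⟨ cong₂ _+_ (∣⊤∣≡n a) ∣T∣≡t ⟩
    a + t                     ≡⟨ 1+k+t≡r ⟩
    r                         ∎
    where open ≡-Reasoning
  edge-card upper (inj₂ refl) = begin
    ∣ image inʳ (T ++ ⊤ {a}) ∣ ≡⟨ ∣image∣≡∣X∣ N inʳ inʳ-strictlyIncreasing (T ++ ⊤ {a}) ⟩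
    ∣ T ++ ⊤ {a} ∣            ≡⟨ ∣p++q∣≡∣p∣+∣q∣ T (⊤ {a}) ⟩
    ∣ T ∣ + ∣ ⊤ {a} ∣         ≡⟨ cong₂ _+_ ∣T∣≡t (∣⊤∣≡n a) ⟩
    t + a                     ≡⟨ ℕ.+-comm t a ⟩
    a + t                     ≡⟨ 1+k+t≡r ⟩
    r                         ∎
    where open ≡-Reasoning

  edge-liesIn : ∀ h {U v} → EdgeIn h U → v ∈ U → v liesIn h
  edge-liesIn h (inj₁ (S , _ , refl)) v∈ with ∈-image⁻ (copy h) {S} v∈
  ... | x , _ , refl = copy-liesIn h x
  edge-liesIn h (inj₂ refl) v∈ = cap-liesIn h v∈

  module Pullback (h : Half) {T′ : Subset N} {S : Subset m}
                  (∣T′∣≡t : ∣ T′ ∣ ≡ t) (T′⊆S : T′ ⊆ image (copy h) S) where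

    P : Subset m
    P = preimage (copy h) T′

    image-P : image (copy h) P ≡ T′
    image-P = image-preimage (copy h) T′⊆S

    ∣P∣≡t : ∣ P ∣ ≡ t
    ∣P∣≡t = trans (sym (∣image∣≡∣X∣ N (copy h) (copy-strictlyIncreasing h) P))
                  (trans (cong ∣_∣ image-P) ∣T′∣≡t)

    P⊆ : ∀ {S′} → T′ ⊆ image (copy h) S′ → P ⊆ S′
    P⊆ T′⊆S′ = image-⊆⇒⊆ (copy h) (copy-injective h) (subst (_⊆ _) (sym image-P) T′⊆S′)

    P⊆T : T′ ⊆ cap h → P ⊆ T
    P⊆T T′⊆cap x∈P = copy∈cap⇒∈T h (T′⊆cap (∈-preimage⁻ (copy h) x∈P))

  t-set-not-in-copy-edge-and-cap : ∀ h {T′ : Subset N} {S : Subset m} → ∣ T′ ∣ ≡ t →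
                                   T′ ⊆ image (copy h) S → T′ ⊆ cap h → ¬ Edge F S ≡ true
  t-set-not-in-copy-edge-and-cap h ∣T′∣≡t T′⊆S T′⊆cap S-edge =
    T-uncovered _ S-edge (subst (_⊆ _) P≡T (P⊆ T′⊆S))
    where
    open Pullback h ∣T′∣≡t T′⊆S
    P≡T : P ≡ T
    P≡T = p⊆q∧∣p∣≡∣q∣⇒p≡q (P⊆T T′⊆cap) (trans ∣P∣≡t (sym ∣T∣≡t))

  steiner-within : ∀ h {T′ e f} → ∣ T′ ∣ ≡ t → T′ ⊆ e → T′ ⊆ f → EdgeIn h e → EdgeIn h f → e ≡ f
  steiner-within h ∣T′∣≡t T′⊆e T′⊆f (inj₁ (S , S-edge , refl)) (inj₁ (S′ , S′-edge , refl)) =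
    cong (image (copy h)) (steiner F P S S′ ∣P∣≡t (P⊆ T′⊆e) (P⊆ T′⊆f) S-edge S′-edge)
    where open Pullback h ∣T′∣≡t T′⊆e
  steiner-within h ∣T′∣≡t T′⊆e T′⊆f (inj₁ (S , S-edge , refl)) (inj₂ refl) =
    ⊥-elim (t-set-not-in-copy-edge-and-cap h ∣T′∣≡t T′⊆e T′⊆f S-edge)
  steiner-within h ∣T′∣≡t T′⊆e T′⊆f (inj₂ refl) (inj₁ (S , S-edge , refl)) =
    ⊥-elim (t-set-not-in-copy-edge-and-cap h ∣T′∣≡t T′⊆f T′⊆e S-edge)
  steiner-within h _ _ _ (inj₂ refl) (inj₂ refl) = refl

  steinerG : ∀ T′ e f → ∣ T′ ∣ ≡ t → T′ ⊆ e → T′ ⊆ f → IsEdge e → IsEdge f → e ≡ f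
  steinerG T′ e f ∣T′∣≡t T′⊆e T′⊆f (h , e-edge) (h′ , f-edge)
    with v , v∈T′ ← 0<∣p∣⇒Nonempty (subst (0 <_) (sym ∣T′∣≡t) 0<t)
    with refl ← liesIn-unique (edge-liesIn h e-edge (T′⊆e v∈T′)) (edge-liesIn h′ f-edge (T′⊆f v∈T′))
    = steiner-within h ∣T′∣≡t T′⊆e T′⊆f e-edge f-edge

  G : OSteiner r t
  G = record
    { n       = N
    ; Edge    = λ U → does (isEdge? U)
    ; edge-r  = λ U U-edge → let h , U-edgeIn = does≡true⇒ (isEdge? U) U-edge in edge-card h U-edgeIn
    ; steiner = λ T′ e f ∣T′∣≡t T′⊆e T′⊆f e-edge f-edge →
        steinerG T′ e f ∣T′∣≡t T′⊆e T′⊆f (does≡true⇒ (isEdge? e) e-edge) (does≡true⇒ (isEdge? f) f-edge)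
    }

  T-nonempty : Nonempty T
  T-nonempty = 0<∣p∣⇒Nonempty (subst (0 <_) (sym ∣T∣≡t) 0<t)

  0<r : 0 < r
  0<r = subst (0 <_) 1+k+t≡r (s≤s z≤n)

  copy-reflects-edges : ∀ h S → IsEdge (image (copy h) S) → Edge F S ≡ true
  copy-reflects-edges h S (h′ , edge)
    with v , v∈ ← 0<∣p∣⇒Nonempty (subst (0 <_) (sym (edge-card h′ edge)) 0<r)
    with x , _ , refl ← ∈-image⁻ (copy h) {S} v∈
    with refl ← liesIn-unique (copy-liesIn h x) (edge-liesIn h′ edge v∈)
    with edge
  ... | inj₁ (S′ , S′-edge , image≡) =
    subst (λ X → Edge F X ≡ true) (sym (image-injective (copy h) (copy-injective h) image≡)) S′-edge
  ... | inj₂ image≡cap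
    with y , _ , y↦corner ← ∈-image⁻ (copy h) {S} (subst (corner h ∈_) (sym image≡cap) (corner∈cap h))
    = contradiction (sym y↦corner) (corner≢copy h y)

  copy-embedding : Half → Embedding F G
  copy-embedding h = record
    { map      = copy h
    ; monotone = copy-strictlyIncreasing h
    ; induced  = λ S → sym (does≡⇔ (isEdge? (image (copy h) S))
                             (mk⇔ (copy-reflects-edges h S) (λ S-edge → h , inj₁ (S , S-edge , refl))))
    }

  module Host (H : OSteiner r t) (ψ : Embedding G H) where

    copyᴴ : Half → Fin m → Fin (n H)
    copyᴴ h x = map ψ (copy h x)

    copyᴴ-strictlyIncreasing : ∀ h → StrictlyIncreasing (copyᴴ h)
    copyᴴ-strictlyIncreasing h = ∘-strictlyIncreasing (copy-strictlyIncreasing h) (monotone ψ)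

    capᴴ : Half → Subset (n H)
    capᴴ h = image (map ψ) (cap h)

    capᴴ-edge : ∀ h → Edge H (capᴴ h) ≡ true
    capᴴ-edge h = trans (sym (induced ψ (cap h))) (dec-true (isEdge? (cap h)) (h , inj₂ refl))

    select-copyᴴ : ∀ h → select (image (copyᴴ h) ⊤) (toList T) ≡ image (copyᴴ h) T
    select-copyᴴ h = select-image (n H) (copyᴴ h) (copyᴴ-strictlyIncreasing h) T

    T-copyᴴ⊆capᴴ : ∀ h → image (copyᴴ h) T ⊆ capᴴ h
    T-copyᴴ⊆capᴴ h v∈ with x , x∈T , refl ← ∈-image⁻ (copyᴴ h) {T} v∈ = ∈-image⁺ (map ψ) (copy∈cap h x∈T)

    lower-extendsBelow : ExtendsBelow H (toList T) (image (copyᴴ lower) ⊤)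
    lower-extendsBelow =
      capᴴ lower , capᴴ-edge lower ,
      subst (_⊆ capᴴ lower) (sym (select-copyᴴ lower)) (T-copyᴴ⊆capᴴ lower) ,
      map ψ (corner lower) , ∈-image⁺ (map ψ) (corner∈cap lower) , corner-below
      where
      corner-below : ∀ v → v ∈ image (copyᴴ lower) ⊤ → map ψ (corner lower) <ᶠ v
      corner-below v v∈ with x , _ , refl ← ∈-image⁻ (copyᴴ lower) {⊤} v∈ =
        monotone ψ _ _ (corner<copy-lower x)

    edge⊇T-copyᴴ-upper⇒capᴴ : ∀ {e} → Edge H e ≡ true → image (copyᴴ upper) T ⊆ e → e ≡ capᴴ upper
    edge⊇T-copyᴴ-upper⇒capᴴ {e} e-edge T-copyᴴ⊆e = steiner H (image (copyᴴ upper) T) e (capᴴ upper)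
      (trans (∣image∣≡∣X∣ (n H) (copyᴴ upper) (copyᴴ-strictlyIncreasing upper) T) ∣T∣≡t)
      T-copyᴴ⊆e (T-copyᴴ⊆capᴴ upper) e-edge (capᴴ-edge upper)

    upper-¬extendsBelow : ¬ ExtendsBelow H (toList T) (image (copyᴴ upper) ⊤)
    upper-¬extendsBelow (e , e-edge , select⊆e , y , y∈e , y-below)
      with refl ← edge⊇T-copyᴴ-upper⇒capᴴ e-edge (subst (_⊆ e) (select-copyᴴ upper) select⊆e)
      with z , z∈cap , refl ← ∈-image⁻ (map ψ) {cap upper} y∈e
      with cap-upper-inside-or-above z∈cap
    ... | inj₁ (w , _ , refl) = ℕ.<-irrefl refl (y-below _ (∈-image⁺ (copyᴴ upper) ∈⊤))
    ... | inj₂ copy<z with x , _ ← T-nonempty =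
      ℕ.<-asym (y-below _ (∈-image⁺ (copyᴴ upper) ∈⊤)) (monotone ψ _ _ (copy<z x))

    copies-coloured-differently :
      colouring H (toList T) (image (copyᴴ lower) (tabulate (λ _ → true))) ≢
      colouring H (toList T) (image (copyᴴ upper) (tabulate (λ _ → true)))
    copies-coloured-differently
      rewrite tabulate-true≡⊤ m
            | dec-true  (extendsBelow? H (toList T) (image (copyᴴ lower) ⊤)) lower-extendsBelow
            | dec-false (extendsBelow? H (toList T) (image (copyᴴ upper) ⊤)) upper-¬extendsBelow
      = λ ()

  G-not-arrowed : ∀ H → ¬ Arrows H G F 2
  G-not-arrowed H arrows with ψ , _ , monochromatic ← arrows (colouring H (toList T)) =
    Host.copies-coloured-differently H ψ
      (trans (monochromatic (copy-embedding lower)) (sym (monochromatic (copy-embedding upper))))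

uncovered⇒¬RamseyProperty : ∀ {r t} (F : OSteiner r t) → 0 < t → t < r → (T : Subset (n F)) → ∣ T ∣ ≡ t →
                            (∀ e → Edge F e ≡ true → ¬ T ⊆ e) → ¬ RamseyProperty r t F
uncovered⇒¬RamseyProperty {r} {t} F 0<t t<r T ∣T∣≡t T-uncovered ramsey =
  let H , H→G = ramsey G 2 (s≤s z≤n) in G-not-arrowed H H→G
  where
  k : ℕ
  k = proj₁ (ℕ.m≤n⇒∃[o]m+o≡n t<r)
  1+k+t≡r : suc k + t ≡ r
  1+k+t≡r = trans (cong suc (ℕ.+-comm k t)) (proj₂ (ℕ.m≤n⇒∃[o]m+o≡n t<r))
  open Gadget F k 1+k+t≡r 0<t T ∣T∣≡t T-uncovered

ramsey⇒complete : ∀ {r t} (F : OSteiner r t) → 0 < t → t < r → RamseyProperty r t F → Complete F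
ramsey⇒complete F 0<t t<r ramsey T ∣T∣≡t with anySubset? (λ e → (Edge F e Bool.≟ true) ×-dec (T ⊆? e))
... | yes covered  = covered
... | no  ¬covered = contradiction ramsey
  (uncovered⇒¬RamseyProperty F 0<t t<r T ∣T∣≡t (λ e e-edge T⊆e → ¬covered (e , e-edge , T⊆e)))

lemma3p4 : ∀ (r t : ℕ) → 2 ≤ t → t < r → (F : OSteiner r t) →
    ¬ Complete F → ¬ RamseyProperty r t F
lemma3p4 r t 2≤t t<r F ¬complete ramsey =
  ¬complete (ramsey⇒complete F (ℕ.<-≤-trans (s≤s z≤n) 2≤t) t<r ramsey)
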